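{- For every $F:\{0,1\}^n\times\{0,1\}^n\to\{0,1\}$, $\mathsf{GBBP}(F)\le\mathsf{BBP}(F)\le\mathsf{GBBP}(F)^2$.
   Context: A branching program is a directed acyclic graph with a source node and two sink nodes labelled $0$ and $1$; its size is the number of nodes. A bipartite branching program for $F$ is such a program where every non-sink node has out-degree two with edges labelled $0,1$, and is labelled either by an arbitrary function $f:\{0,1\}^n\to\{0,1\}$ (evaluated on Alice's input $x$) or by an arbitrary function $g:\{0,1\}^n\to\{0,1\}$ (evaluated on Bob's input $y$); on input $(x,y)$ one walks from the source, following at each node the edge labelled by the node's function value; it computes $F$ if the walk always ends at the sink labelled $F(x,y)$. A generalized bipartite branching program is the same except that a non-sink node may have any out-degree $k\ge1$, with outgoing edges labelled $1,\dots,k$, and is labelled by a function $f:\{0,1\}^n\to[k]$ of $x$ or $g:\{0,1\}^n\to[k]$ of $y$. $\mathsf{BBP}(F)$ and $\mathsf{GBBP}(F)$ are the minimum sizes of bipartite, resp. generalized bipartite, branching programs computing $F$. -}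

module Defs where

open import Data.Nat using (ℕ; _+_; _*_; _≤_; _<_)
open import Data.Fin using (Fin; toℕ)
open import Data.Bool using (Bool)
open import Data.Vec using (Vec)
open import Data.Sum using (_⊎_; inj₁; inj₂)
open import Data.Product using (Σ; _×_)
open import Data.Unit using (⊤)
open import Relation.Binary.PropositionalEquality using (_≡_)

Input : ℕ → Set
Input n = Vec Bool n

-- Nodes of a program with m non-sink nodes: the non-sink nodes plus the
-- two sinks labelled false (0) and true (1).  Size = m + 2.
data Node (m : ℕ) : Set where
  inner : Fin m → Node m
  sink  : Bool → Node m

-- Acyclicity via a topological order: every edge out of non-sink node i
-- goes to a sink or to a non-sink node of larger index.
Above : {m : ℕ} → Fin m → Node m → Set
Above i (inner j) = toℕ i < toℕ j
Above i (sink _)  = ⊤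

record BBProg (n m : ℕ) : Set where
  field
    source  : Node m
    -- inj₁ f : node queries Alice's input x; inj₂ g : node queries Bob's input y
    label   : Fin m → (Input n → Bool) ⊎ (Input n → Bool)
    next    : Fin m → Bool → Node m
    acyclic : ∀ i e → Above i (next i e)

bbValue : {n m : ℕ} → ((Input n → Bool) ⊎ (Input n → Bool)) → Input n → Input n → Bool
bbValue (inj₁ f) x y = f x
bbValue (inj₂ g) x y = g y

data BBWalk {n m : ℕ} (P : BBProg n m) (x y : Input n) : Node m → Bool → Set where
  done : ∀ b → BBWalk P x y (sink b) b
  step : ∀ i b →
         BBWalk P x y (BBProg.next P i (bbValue {n} {m} (BBProg.label P i) x y)) b →
         BBWalk P x y (inner i) b

BBComputes : {n m : ℕ} → BBProg n m → (Input n → Input n → Bool) → Set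
BBComputes {n} P F = ∀ (x y : Input n) → BBWalk P x y (BBProg.source P) (F x y)

record GBBProg (n m : ℕ) : Set where
  field
    source  : Node m
    deg     : Fin m → ℕ
    deg≥1   : ∀ i → 1 ≤ deg i
    label   : (i : Fin m) → (Input n → Fin (deg i)) ⊎ (Input n → Fin (deg i))
    next    : (i : Fin m) → Fin (deg i) → Node m
    acyclic : ∀ i e → Above i (next i e)

gbValue : {n k : ℕ} → ((Input n → Fin k) ⊎ (Input n → Fin k)) → Input n → Input n → Fin k
gbValue (inj₁ f) x y = f x
gbValue (inj₂ g) x y = g y

data GBWalk {n m : ℕ} (P : GBBProg n m) (x y : Input n) : Node m → Bool → Set where
  done : ∀ b → GBWalk P x y (sink b) b
  step : ∀ i b →
         GBWalk P x y (GBBProg.next P i (gbValue (GBBProg.label P i) x y)) b →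
         GBWalk P x y (inner i) b

GBComputes : {n m : ℕ} → GBBProg n m → (Input n → Input n → Bool) → Set
GBComputes {n} P F = ∀ (x y : Input n) → GBWalk P x y (GBBProg.source P) (F x y)

HasBBPOfSize : {n : ℕ} → (Input n → Input n → Bool) → ℕ → Set
HasBBPOfSize {n} F s = Σ ℕ λ m → (m + 2 ≡ s) × Σ (BBProg n m) λ P → BBComputes P F

HasGBBPOfSize : {n : ℕ} → (Input n → Input n → Bool) → ℕ → Set
HasGBBPOfSize {n} F s = Σ ℕ λ m → (m + 2 ≡ s) × Σ (GBBProg n m) λ P → GBComputes P F

IsMinimum : (ℕ → Set) → ℕ → Set
IsMinimum Q s = Q s × (∀ t → Q t → s ≤ t)

IsBBP : {n : ℕ} → (Input n → Input n → Bool) → ℕ → Set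
IsBBP F = IsMinimum (HasBBPOfSize F)

IsGBBP : {n : ℕ} → (Input n → Input n → Bool) → ℕ → Set
IsGBBP F = IsMinimum (HasGBBPOfSize F)

module Submission where

-- The lower bound is immediate: a bipartite program is a generalized one all
-- of whose nodes have degree 2 (reading the Boolean edge labels as Fin 2).
--
-- For the upper bound, a generalized program with m inner nodes is simulated
-- by a binary one with m · (m + 1) inner nodes.  Every target of a walk step
-- gets a rank: inner node j has rank j, sink 0 rank m, sink 1 rank m + 1.
-- Inner node i is replaced by a chain of binary nodes (i , 0), …, (i , m);
-- node (i , c) asks (on the same player's input as i) whether the successor
-- of i has rank c.  On "yes" it jumps to the start (j , 0) of the chain of
-- inner node j = c, or to sink 0 when c = m; on "no" it moves on to (i , c+1),
-- or to sink 1 after the last test.  Pairs (i , c) are flattened into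
-- Fin (m * (m + 1)) lexicographically, so the topological order is kept.

open import Defs
open import Data.Nat using (ℕ; _≤_; _*_)
open import Data.Product using (_×_)
open import Data.Bool using (Bool)

open import Data.Nat using (zero; suc; _+_; _<_; _<?_; _≟_; z≤n; s≤s; z<s)
open import Data.Nat.Properties
  using (≤-trans; n≤1+n; m≤m+n; <⇒≢; +-identityʳ; +-suc; +-monoʳ-<; n<1+n; m<m+n)
open import Data.Fin using (Fin; toℕ; combine; remQuot; inject₁; fromℕ)
open import Data.Fin.Properties
  using (2↔Bool; toℕ-combine; combine-monoˡ-<; remQuot-combine; combine-remQuot;
         toℕ-inject₁; inject₁ℕ<; toℕ<n; toℕ-fromℕ; toℕ-injective)
open import Data.Fin.Relation.Unary.Top using (View; view; ‵fromℕ; ‵inject₁)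
open import Data.Bool using (true; false)
open import Data.Sum using (_⊎_; inj₁; inj₂)
import Data.Sum as Sum
open import Data.Product using (Σ; _,_; proj₁; proj₂)
open import Data.Unit using (tt)
open import Function using (_∘′_)
open import Function.Bundles using (Inverse)
open import Relation.Nullary using (yes; no; does; contradiction)
open import Relation.Nullary.Decidable using (dec-true; dec-false)
open import Relation.Binary.PropositionalEquality
  using (_≡_; _≢_; refl; sym; trans; cong; subst; module ≡-Reasoning)

Query : ℕ → Set → Set
Query n A = (Input n → A) ⊎ (Input n → A)

relabel : {n : ℕ} {A B : Set} → (A → B) → Query n A → Query n B
relabel h = Sum.map (h ∘′_) (h ∘′_)

bbValue-relabel : ∀ {n m k} (h : Fin k → Bool) (q : Query n (Fin k)) x y →
                  bbValue {n} {m} (relabel h q) x y ≡ h (gbValue q x y)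
bbValue-relabel h (inj₁ f) x y = refl
bbValue-relabel h (inj₂ g) x y = refl

gbValue-relabel : ∀ {n m k} (h : Bool → Fin k) (q : Query n Bool) x y →
                  gbValue (relabel h q) x y ≡ h (bbValue {n} {m} q x y)
gbValue-relabel h (inj₁ f) x y = refl
gbValue-relabel h (inj₂ g) x y = refl

module AsGeneralized {n m : ℕ} (P : BBProg n m) where
  open BBProg P
  open Inverse 2↔Bool using (to; from; strictlyInverseˡ)

  program : GBBProg n m
  program = record
    { source  = source
    ; deg     = λ _ → 2
    ; deg≥1   = λ _ → s≤s z≤n
    ; label   = λ i → relabel from (label i)
    ; next    = λ i e → next i (to e)
    ; acyclic = λ i e → acyclic i (to e)
    }

  answer : ∀ i x y → to (gbValue (relabel from (label i)) x y) ≡ bbValue {n} {m} (label i) x y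
  answer i x y = trans (cong to (gbValue-relabel {m = m} from (label i) x y)) (strictlyInverseˡ _)

  walk : ∀ {x y v b} → BBWalk P x y v b → GBWalk program x y v b
  walk (done b) = done b
  walk {x} {y} (step i b w) =
    step i b (subst (λ e → GBWalk program x y (next i e) b) (sym (answer i x y)) (walk w))

bbp⇒gbbp : ∀ {n} (F : Input n → Input n → Bool) s → HasBBPOfSize F s → HasGBBPOfSize F s
bbp⇒gbbp F s (m , size , P , computes) =
  m , size , AsGeneralized.program P , λ x y → AsGeneralized.walk P (computes x y)

record PairProg (n m k : ℕ) : Set where
  field
    source  : Node (m * k)
    label   : Fin m → Fin k → Query n Bool
    next    : Fin m → Fin k → Bool → Node (m * k)
    acyclic : ∀ i c e → Above (combine i c) (next i c e)

module Flatten {n m k : ℕ} (P : PairProg n m k) where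
  open PairProg P

  program : BBProg n (m * k)
  program = record
    { source  = source
    ; label   = λ a → label (proj₁ (split a)) (proj₂ (split a))
    ; next    = λ a → next (proj₁ (split a)) (proj₂ (split a))
    ; acyclic = λ a e → subst (λ a′ → Above a′ (next (proj₁ (split a)) (proj₂ (split a)) e))
                              (combine-remQuot {m} k a)
                              (acyclic (proj₁ (split a)) (proj₂ (split a)) e)
    }
    where
    split : Fin (m * k) → Fin m × Fin k
    split = remQuot {m} k

  step-at : ∀ {x y b} i c →
            BBWalk program x y (next i c (bbValue {n} {m * k} (label i c) x y)) b →
            BBWalk program x y (inner (combine i c)) b
  step-at {x} {y} {b} i c w =
    step (combine i c) b
      (subst (λ p → BBWalk program x y
                      (next (proj₁ p) (proj₂ p) (bbValue {n} {m * k} (label (proj₁ p) (proj₂ p)) x y)) b)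
             (sym (remQuot-combine i c)) w)

combine-inject₁<combine-suc : ∀ {m k} (i : Fin m) (c : Fin k) →
                              toℕ (combine i (inject₁ c)) < toℕ (combine {n = suc k} i (Fin.suc c))
combine-inject₁<combine-suc {k = k} i c
  rewrite toℕ-combine i (inject₁ c) | toℕ-combine i (Fin.suc c) | toℕ-inject₁ c =
  +-monoʳ-< (suc k * toℕ i) (n<1+n (toℕ c))

module Simulation {n m : ℕ} (P : GBBProg n m) where
  open GBBProg P

  M : ℕ
  M = m * suc m

  rank : Node m → ℕ
  rank (inner j)    = toℕ j
  rank (sink false) = m
  rank (sink true)  = suc m

  embed : Node m → Node M
  embed (inner j) = inner (combine j Fin.zero)
  embed (sink b)  = sink b

  hits : Node m → Fin (suc m) → Bool
  hits t c = does (rank t ≟ toℕ c)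

  -- Edge from the chain of i to the chain of j; redirected to a sink when
  -- it would go backwards (such an edge is never taken, as P is acyclic).
  forward : Fin m → Fin m → Node M
  forward i j with toℕ i <? toℕ j
  ... | yes _ = embed (inner j)
  ... | no _  = sink false

  forward-above : ∀ i j (c : Fin (suc m)) → Above (combine i c) (forward i j)
  forward-above i j c with toℕ i <? toℕ j
  ... | yes i<j = combine-monoˡ-< c Fin.zero i<j
  ... | no _    = tt

  forward-taken : ∀ {i j} → Above i (inner j) → forward i j ≡ embed (inner j)
  forward-taken {i} {j} i<j with toℕ i <? toℕ j
  ... | yes _   = refl
  ... | no i≮j  = contradiction i<j i≮j

  gadgetNext : Fin m → {c : Fin (suc m)} → View c → Bool → Node M
  gadgetNext i ‵fromℕ        true  = sink false
  gadgetNext i ‵fromℕ        false = sink true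
  gadgetNext i (‵inject₁ j)  true  = forward i j
  gadgetNext i (‵inject₁ j)  false = inner (combine i (Fin.suc j))

  gadgetNext-above : ∀ i {c} (v : View c) e → Above (combine i c) (gadgetNext i v e)
  gadgetNext-above i ‵fromℕ       true  = tt
  gadgetNext-above i ‵fromℕ       false = tt
  gadgetNext-above i (‵inject₁ j) true  = forward-above i j (inject₁ j)
  gadgetNext-above i (‵inject₁ j) false = combine-inject₁<combine-suc i j

  gadget : PairProg n m (suc m)
  gadget = record
    { source  = embed source
    ; label   = λ i c → relabel (λ e → hits (next i e) c) (label i)
    ; next    = λ i c → gadgetNext i (view c)
    ; acyclic = λ i c → gadgetNext-above i (view c)
    }

  program : BBProg n M
  program = Flatten.program gadget

  hit-correct : ∀ i {t c} (v : View c) → Above i t → rank t ≡ toℕ c → gadgetNext i v true ≡ embed t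
  hit-correct i {inner j}    ‵fromℕ       _   eq = contradiction (trans eq (toℕ-fromℕ m)) (<⇒≢ (toℕ<n j))
  hit-correct i {sink false} ‵fromℕ       _   eq = refl
  hit-correct i {sink true}  ‵fromℕ       _   eq = contradiction (trans (sym (toℕ-fromℕ m)) (sym eq)) (<⇒≢ (n<1+n m))
  hit-correct i {inner j′}   (‵inject₁ j) i<j′ eq
    rewrite toℕ-injective {i = j′} {j = j} (trans eq (toℕ-inject₁ j)) = forward-taken i<j′
  hit-correct i {sink false} (‵inject₁ j) _   eq = contradiction (sym eq) (<⇒≢ (inject₁ℕ< j))
  hit-correct i {sink true}  (‵inject₁ j) _   eq =
    contradiction (sym eq) (<⇒≢ (≤-trans (inject₁ℕ< j) (n≤1+n m)))

  beyond-last : ∀ t d → rank t ≡ toℕ (fromℕ m) + suc d → t ≡ sink true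
  beyond-last (inner j)    d eq = contradiction (trans eq (cong (_+ suc d) (toℕ-fromℕ m)))
                                    (<⇒≢ (≤-trans (toℕ<n j) (m≤m+n m (suc d))))
  beyond-last (sink false) d eq = contradiction (trans eq (cong (_+ suc d) (toℕ-fromℕ m)))
                                    (<⇒≢ (subst (m <_) (sym (+-suc m d)) (s≤s (m≤m+n m d))))
  beyond-last (sink true)  d eq = refl

  module _ (x y : Input n) where
    succ : Fin m → Node m
    succ i = next i (gbValue (label i) x y)

    test : ∀ i c {b} → BBWalk program x y (gadgetNext i (view c) (hits (succ i) c)) b →
           BBWalk program x y (inner (combine i c)) b
    test i c {b} w =
      Flatten.step-at gadget i c
        (subst (λ e → BBWalk program x y (gadgetNext i (view c) e) b)
               (sym (bbValue-relabel {m = M} (λ e → hits (next i e) c) (label i) x y)) w)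

    chain : ∀ i {b} → BBWalk program x y (embed (succ i)) b →
            ∀ d c → toℕ c + d ≡ rank (succ i) → BBWalk program x y (inner (combine i c)) b
    chain i {b} w zero c eq =
      test i c (subst (λ e → BBWalk program x y (gadgetNext i (view c) e) b)
                      (sym (dec-true (rank (succ i) ≟ toℕ c) at-rank))
                      (subst (λ v → BBWalk program x y v b)
                             (sym (hit-correct i (view c) (acyclic i _) at-rank)) w))
      where
      at-rank : rank (succ i) ≡ toℕ c
      at-rank = trans (sym eq) (+-identityʳ (toℕ c))
    chain i {b} w (suc d) c eq =
      test i c (subst (λ e → BBWalk program x y (gadgetNext i (view c) e) b)
                      (sym (dec-false (rank (succ i) ≟ toℕ c) before-rank))
                      (miss (view c) eq))
      where
      open ≡-Reasoning
      before-rank : rank (succ i) ≢ toℕ c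
      before-rank r = <⇒≢ (m<m+n (toℕ c) z<s) (sym (trans eq r))
      miss : ∀ {c} (v : View c) → toℕ c + suc d ≡ rank (succ i) → BBWalk program x y (gadgetNext i v false) b
      miss ‵fromℕ       eq′ = subst (λ t → BBWalk program x y (embed t) b) (beyond-last _ d (sym eq′)) w
      miss (‵inject₁ j) eq′ = chain i w d (Fin.suc j) (begin
        suc (toℕ j + d)           ≡⟨ cong (λ k → suc (k + d)) (toℕ-inject₁ j) ⟨
        suc (toℕ (inject₁ j) + d) ≡⟨ +-suc _ d ⟨
        toℕ (inject₁ j) + suc d   ≡⟨ eq′ ⟩
        rank (succ i)             ∎)

    simulate : ∀ {v b} → GBWalk P x y v b → BBWalk program x y (embed v) b
    simulate (done b)     = done b
    simulate (step i b w) = chain i (simulate w) (rank (succ i)) Fin.zero refl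

square-bound : ∀ m → m * suc m + 2 ≤ (m + 2) * (m + 2)
square-bound m = subst (m * suc m + 2 ≤_) (sym expand) (m≤m+n (m * suc m + 2) (3 * m + 2))
  where
  open import Data.Nat.Solver using (module +-*-Solver)
  open +-*-Solver
  expand : (m + 2) * (m + 2) ≡ m * suc m + 2 + (3 * m + 2)
  expand = solve 1 (λ m → (m :+ con 2) :* (m :+ con 2) := m :* (con 1 :+ m) :+ con 2 :+ (con 3 :* m :+ con 2)) refl m

gbbp⇒square-bbp : ∀ {n} (F : Input n → Input n → Bool) s → HasGBBPOfSize F s →
                  Σ ℕ λ t → HasBBPOfSize F t × t ≤ s * s
gbbp⇒square-bbp F .(m + 2) (m , refl , P , computes) =
  m * suc m + 2 ,
  (m * suc m , refl , Simulation.program P , λ x y → Simulation.simulate P x y (computes x y)) ,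
  square-bound m

fact4p9 : (n : ℕ) (F : Input n → Input n → Bool) (g b : ℕ) → IsGBBP F g → IsBBP F b → g ≤ b × b ≤ g * g
fact4p9 n F g b (gbbp-g , g-minimal) (bbp-b , b-minimal)
  with gbbp⇒square-bbp F g gbbp-g
... | t , bbp-t , t≤g² = g-minimal b (bbp⇒gbbp F b bbp-b) , ≤-trans (b-minimal t bbp-t) t≤g²
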